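{- Let $n$ be a positive integer and let $\Delta$ be the checked triangular grid of order $n$ described in the context, with dark tiles, inscribed grid and overall grid as defined there. Let $S_n$ be the set of S-paths and $W_n$ the set of W-paths of order $n$. For an S-path $P$, let $\Phi(P)$ be the path on the inscribed grid that visits the centroids of the dark tiles in exactly the order in which the successive edges of $P$ lie on those tiles. Then $\Phi$ is a bijection from $S_n$ onto $W_n$. In particular $|W_n| = |S_n|$.
   Context: Take an equilateral triangle with corners $A$ (bottom-left), $B$ (bottom-right) and $C$ (top, lying counterclockwise from the ray $AB$), and divide each side into $n$ equal parts of unit length. Drawing the segments through the division points parallel to the sides partitions it into $n^2$ unit equilateral subtriangles; those facing upward (same orientation as $ABC$) are the dark tiles (there are $T_n=n(n+1)/2$ of them), the others are white. Every unit segment of this subdivision is a side of exactly one dark tile. Overall grid: the $T_{n+1}$ vertices of the subdivision (corners of the dark tiles). Inscribed grid: the $T_n$ centroids of the dark tiles; two such centroids are adjacent if they are at the minimal distance (the unit length), i.e. the inscribed grid is itself a triangular grid. Direction codes: a directed segment whose direction makes angle $d\pi/3$ (measured counterclockwise from the direction of $AB$) has direction code $d\in\{0,1,\dots,5\}$. H-path: a Hamiltonian path on the inscribed grid using only edges between adjacent centroids, starting at the leftmost centroid (that of the dark tile at corner $A$) and ending at the rightmost centroid (that of the dark tile at corner $B$). It is described by the string $h=d_1d_2\cdots d_{T_n-1}$ of direction codes of its consecutive edges. W-path (well-formed H-path): an H-path such that, writing the supplemented string $0\,d_1d_2\cdots d_{T_n-1}\,0$ as $e_0e_1\cdots e_{T_n}$,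 for every consecutive pair $(e_i,e_{i+1})$ we have $e_{i+1}\not\equiv e_i+4 \pmod 6$ if $e_i$ is even and $e_{i+1}\not\equiv e_i+2\pmod 6$ if $e_i$ is odd. S-path: a self-avoiding path (no repeated vertex) on the overall grid, from corner $A$ to corner $B$, consisting of exactly $T_n$ unit edges of the subdivision, such that the dark tiles on which its edges lie are pairwise distinct (so each dark tile carries exactly one edge of the path). -}

module Defs where

open import Data.Nat as ℕ using (ℕ; zero; suc)
open import Data.Integer as ℤ using (ℤ; +_; -[1+_]; 0ℤ; 1ℤ; _⊓_)
open import Data.Fin using (Fin; zero; suc; toℕ)
open import Data.Product using (Σ; _×_; _,_; proj₁; proj₂; ∃)
open import Data.List using (List; []; _∷_; _++_; [_]; head; last; length)
open import Data.Maybe using (just)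
open import Data.List.Relation.Unary.All using (All)
open import Data.List.Relation.Unary.Linked using (Linked)
open import Data.List.Relation.Unary.Unique.Propositional using (Unique)
open import Data.List.Membership.Propositional using (_∈_)
open import Relation.Binary.PropositionalEquality using (_≡_)
open import Relation.Nullary using (¬_)

-- A point i·e₀ + j·e₁ of the plane, where e₀ is the unit
-- vector in the direction of AB and e₁ the unit vector at angle π/3
-- (counterclockwise), is represented by (i , j).  A = (0,0), B = (n,0),
-- C = (0,n).

Pt : Set
Pt = ℤ × ℤ

_+ₚ_ : Pt → Pt → Pt
(a , b) +ₚ (c , d) = (a ℤ.+ c , b ℤ.+ d)

Dir : Set
Dir = Fin 6

-- unit vector of direction code d (angle dπ/3) in (e₀,e₁)-coordinates
step : Dir → Pt
step zero                                  = (+ 1 , 0ℤ)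
step (suc zero)                            = (0ℤ , + 1)
step (suc (suc zero))                      = (-[1+ 0 ] , + 1)
step (suc (suc (suc zero)))                = (-[1+ 0 ] , 0ℤ)
step (suc (suc (suc (suc zero))))          = (0ℤ , -[1+ 0 ])
step (suc (suc (suc (suc (suc zero)))))    = (+ 1 , -[1+ 0 ])

T : ℕ → ℕ
T zero    = zero
T (suc n) = suc n ℕ.+ T n

Vertex : ℕ → Pt → Set
Vertex n (i , j) = (0ℤ ℤ.≤ i) × (0ℤ ℤ.≤ j) × (i ℤ.+ j ℤ.≤ + n)

-- Dark tiles: the dark tile with corners (i,j), (i+1,j), (i,j+1), for
-- i,j ≥ 0, i + j ≤ n - 1, is represented by (i , j).  Its centroid is
-- (i + 1/3 , j + 1/3); since centroids are the tile representatives
-- translated by a fixed vector, the inscribed grid (centroids, with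
-- adjacency at unit distance) is identified with this set of points with
-- adjacency "differ by some step d".
DarkTile : ℕ → Pt → Set
DarkTile n (i , j) = (0ℤ ℤ.≤ i) × (0ℤ ℤ.≤ j) × (i ℤ.+ j ℤ.< + n)

-- The dark tile on which the unit segment {u , v} lies.  For the three
-- sides of the dark tile (i,j) -- {(i,j),(i+1,j)}, {(i,j),(i,j+1)},
-- {(i+1,j),(i,j+1)} -- the coordinatewise minimum of the endpoints is
-- exactly (i,j).
tileOf : Pt → Pt → Pt
tileOf (a , b) (c , d) = (a ⊓ c , b ⊓ d)

Φ : List Pt → List Pt
Φ (u ∷ v ∷ rest) = tileOf u v ∷ Φ (v ∷ rest)
Φ _              = []

Adj : Pt → Pt → Set
Adj u v = ∃ λ (d : Dir) → v ≡ u +ₚ step d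

data Walk : List Pt → List Dir → Set where
  single : ∀ p → Walk [ p ] []
  step∷  : ∀ {p q ps ds} (d : Dir) → q ≡ p +ₚ step d →
           Walk (q ∷ ps) ds → Walk (p ∷ q ∷ ps) (d ∷ ds)

record HPath (n : ℕ) (H : List Pt) (h : List Dir) : Set where
  field
    walk     : Walk H h
    start    : head H ≡ just (0ℤ , 0ℤ)
    end      : last H ≡ just (+ n ℤ.- 1ℤ , 0ℤ)
    inGrid   : All (DarkTile n) H
    distinct : Unique H
    covers   : ∀ t → DarkTile n t → t ∈ H

offset : ℕ → ℕ
offset zero          = 4
offset (suc zero)    = 2
offset (suc (suc k)) = offset k

Allowed : Dir → Dir → Set
Allowed e e' = ¬ (toℕ e' ≡ (toℕ e ℕ.+ offset (toℕ e)) ℕ.% 6)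

WellFormed : List Dir → Set
WellFormed h = Linked Allowed (zero ∷ h ++ [ zero ])

WPath : ℕ → List Pt → Set
WPath n H = Σ (List Dir) λ h → HPath n H h × WellFormed h

record SPath (n : ℕ) (P : List Pt) : Set where
  field
    start     : head P ≡ just (0ℤ , 0ℤ)
    end       : last P ≡ just (+ n , 0ℤ)
    nEdges    : length P ≡ suc (T n)
    edges     : Linked Adj P
    inGrid    : All (Vertex n) P
    selfAvoid : Unique P
    tilesDist : Unique (Φ P)

-- Every unit segment lies on exactly one dark tile, and consecutive edges of an S-path share a
-- vertex, so their tiles share a corner; two distinct dark tiles sharing a corner are neighbours
-- in the inscribed grid, the shared vertex being the corner through which the path leaves the
-- first tile and enters the second. Hence Φ(P) is a walk on the inscribed grid, without repeated
-- tiles, and Hamiltonian because P has T n edges. Each tile is entered and left through distinct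
-- corners; for a non-backtracking walk this excludes exactly one turn after each direction, which
-- is the W-condition, the supplementary 0s accounting for entering the first tile at A and leaving
-- the last one at B. Conversely a W-path is read back as the sequence of corners through which it
-- passes from tile to tile. These corners are distinct since a vertex is a corner of at most three
-- dark tiles, and they are determined by the tiles since two distinct tiles share at most one corner.
module Submission where

open import Defs
open import Data.Nat using (ℕ; _≤_)
open import Data.List using (List)
open import Data.Product using (Σ; _×_)
open import Relation.Binary.PropositionalEquality using (_≡_)

open import Algebra.Bundles using (AbelianGroup)
import Algebra.Properties.Group as GroupProperties
import Algebra.Properties.Quasigroup as QuasigroupProperties
open import Data.Empty using (⊥)
open import Data.Fin using (Fin; zero; suc; toℕ)
open import Data.Fin.Properties using (toℕ-injective; injective⇒≤) renaming (_≟_ to _≟ᶠ_)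
import Data.Integer as ℤ
open import Data.Integer using (+_; -[1+_]; 0ℤ; 1ℤ; +≤+; +<+)
import Data.Integer.Properties as ℤP
open import Data.List using ([]; _∷_; _++_; [_]; last; length; map; upTo; lookup; allFin)
import Data.List.Properties as List
open import Data.List.Membership.Propositional using (_∈_; _∉_)
open import Data.List.Membership.Propositional.Properties
  using (∈-lookup; ∈-map⁺; ∈-map⁻; ∈-++⁺ˡ; ∈-++⁺ʳ; ∈-++⁻; ∈-upTo⁺; ∈-upTo⁻; ∈-allFin)
open import Data.List.Relation.Binary.Subset.Propositional using (_⊆_)
open import Data.List.Relation.Unary.All as All using (All; []; _∷_)
open import Data.List.Relation.Unary.All.Properties using (All¬⇒¬Any) renaming (++⁺ to ++⁺-All)
open import Data.List.Relation.Unary.AllPairs using ([]; _∷_)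
open import Data.List.Relation.Unary.Any as Any using (here; there)
open import Data.List.Relation.Unary.Any.Properties using (lookup-index)
open import Data.List.Relation.Unary.Linked as Linked using (Linked; [-]; _∷_)
open import Data.List.Relation.Unary.Unique.Propositional using (Unique)
import Data.List.Relation.Unary.Unique.Propositional.Properties as Unique
open import Data.Maybe using (just)
open import Data.Maybe.Properties using (just-injective)
import Data.Nat as ℕ
open import Data.Nat using (zero; suc; z≤n; s≤s)
import Data.Nat.Properties as ℕP
open import Data.Product using (_,_; proj₁; proj₂; ∃)
open import Data.Product.Properties using (≡-dec)
open import Data.Sum using (_⊎_; inj₁; inj₂)
open import Function using (_∘_)
open import Relation.Binary.PropositionalEquality
  using (refl; sym; trans; cong; cong₂; subst; _≢_; module ≡-Reasoning)
open import Relation.Nullary using (¬_; Dec; yes; no; contradiction)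

lookup-injective : ∀ {a} {A : Set a} {xs : List A} → Unique xs → ∀ i j → lookup xs i ≡ lookup xs j → i ≡ j
lookup-injective (_ ∷ _)   zero    zero    _  = refl
lookup-injective (x∉ ∷ _)  zero    (suc j) eq = contradiction eq (All.lookup x∉ (∈-lookup j))
lookup-injective (x∉ ∷ _)  (suc i) zero    eq = contradiction (sym eq) (All.lookup x∉ (∈-lookup i))
lookup-injective (_ ∷ xs!) (suc i) (suc j) eq = cong suc (lookup-injective xs! i j eq)

Unique⇒length≤ : ∀ {a} {A : Set a} {xs ys : List A} → Unique xs → xs ⊆ ys → length xs ≤ length ys
Unique⇒length≤ {xs = xs} {ys} xs! xs⊆ys = injective⇒≤ position-injective
  where
  position : Fin (length xs) → Fin (length ys)
  position i = Any.index (xs⊆ys (∈-lookup i))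

  position-injective : ∀ {i j} → position i ≡ position j → i ≡ j
  position-injective {i} {j} eq = lookup-injective xs! i j (begin
    lookup xs i            ≡⟨ lookup-index (xs⊆ys (∈-lookup i)) ⟩
    lookup ys (position i) ≡⟨ cong (lookup ys) eq ⟩
    lookup ys (position j) ≡⟨ lookup-index (xs⊆ys (∈-lookup j)) ⟨
    lookup xs j            ∎)
    where open ≡-Reasoning

unique-between : ∀ {a p} {A : Set a} {P : A → Set p} {x y : A} {xs : List A} →
                 Unique xs → All P xs → ¬ P x → ¬ P y → x ≢ y → Unique (x ∷ xs ++ [ y ])
unique-between {P = P} xs! xs-P ¬Px ¬Py x≢y =
  ++⁺-All (All.map (λ Pz x≡z → ¬Px (subst P (sym x≡z) Pz)) xs-P) (x≢y ∷ [])
  ∷ Unique.++⁺ xs! ([] ∷ []) (λ { (y∈xs , here refl) → ¬Py (All.lookup xs-P y∈xs) })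

module ℤ-group = GroupProperties (AbelianGroup.group ℤP.+-0-abelianGroup)
module ℤ-quasigroup = QuasigroupProperties ℤ-group.quasigroup

0ₚ : Pt
0ₚ = (0ℤ , 0ℤ)

_-ₚ_ : Pt → Pt → Pt
(a , b) -ₚ (c , d) = (a ℤ.- c , b ℤ.- d)

_≟ₚ_ : (x y : Pt) → Dec (x ≡ y)
_≟ₚ_ = ≡-dec ℤP._≟_ ℤP._≟_

+ₚ-assoc : ∀ x y z → (x +ₚ y) +ₚ z ≡ x +ₚ (y +ₚ z)
+ₚ-assoc (a , b) (c , d) (e , f) = cong₂ _,_ (ℤP.+-assoc a c e) (ℤP.+-assoc b d f)

+ₚ-comm : ∀ x y → x +ₚ y ≡ y +ₚ x
+ₚ-comm (a , b) (c , d) = cong₂ _,_ (ℤP.+-comm a c) (ℤP.+-comm b d)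

+ₚ-identityʳ : ∀ x → x +ₚ 0ₚ ≡ x
+ₚ-identityʳ (a , b) = cong₂ _,_ (ℤP.+-identityʳ a) (ℤP.+-identityʳ b)

+ₚ-cancelˡ : ∀ x {y z} → x +ₚ y ≡ x +ₚ z → y ≡ z
+ₚ-cancelˡ (a , b) {c , d} {e , f} eq =
  cong₂ _,_ (ℤ-quasigroup.cancelˡ a c e (cong proj₁ eq)) (ℤ-quasigroup.cancelˡ b d f (cong proj₂ eq))

x+ₚy≡z⇒x≡z-ₚy : ∀ {x y z} → x +ₚ y ≡ z → x ≡ z -ₚ y
x+ₚy≡z⇒x≡z-ₚy {a , b} {c , d} {e , f} eq =
  cong₂ _,_ (ℤ-quasigroup.x≈z//y a c e (cong proj₁ eq)) (ℤ-quasigroup.x≈z//y b d f (cong proj₂ eq))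

x-ₚy+ₚy≡x : ∀ x y → (x -ₚ y) +ₚ y ≡ x
x-ₚy+ₚy≡x (a , b) (c , d) = cong₂ _,_ (ℤ-group.//-rightDividesˡ c a) (ℤ-group.//-rightDividesˡ d b)

Corner : Set
Corner = Fin 3

pattern c0 = zero
pattern c1 = suc zero
pattern c2 = suc (suc zero)

pattern d0 = zero
pattern d1 = suc zero
pattern d2 = suc (suc zero)
pattern d3 = suc (suc (suc zero))
pattern d4 = suc (suc (suc (suc zero)))
pattern d5 = suc (suc (suc (suc (suc zero))))

cornerOffset : Corner → Pt
cornerOffset c0 = 0ₚ
cornerOffset c1 = (1ℤ , 0ℤ)
cornerOffset c2 = (0ℤ , 1ℤ)

corner : Pt → Corner → Pt
corner (x , y) c0 = (x , y)
corner (x , y) c1 = (1ℤ ℤ.+ x , y)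
corner (x , y) c2 = (x , 1ℤ ℤ.+ y)

corner≡+ₚ : ∀ t a → corner t a ≡ t +ₚ cornerOffset a
corner≡+ₚ t       c0 = sym (+ₚ-identityʳ t)
corner≡+ₚ (x , y) c1 = cong₂ _,_ (ℤP.+-comm 1ℤ x) (sym (ℤP.+-identityʳ y))
corner≡+ₚ (x , y) c2 = cong₂ _,_ (sym (ℤP.+-identityʳ x)) (ℤP.+-comm 1ℤ y)

cornerOffset-injective : ∀ a b → cornerOffset a ≡ cornerOffset b → a ≡ b
cornerOffset-injective c0 c0 _  = refl
cornerOffset-injective c0 c1 ()
cornerOffset-injective c0 c2 ()
cornerOffset-injective c1 c0 ()
cornerOffset-injective c1 c1 _  = refl
cornerOffset-injective c1 c2 ()
cornerOffset-injective c2 c0 ()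
cornerOffset-injective c2 c1 ()
cornerOffset-injective c2 c2 _  = refl

corner-injectiveʳ : ∀ t {a b} → corner t a ≡ corner t b → a ≡ b
corner-injectiveʳ t {a} {b} eq = cornerOffset-injective a b
  (+ₚ-cancelˡ t (trans (sym (corner≡+ₚ t a)) (trans eq (corner≡+ₚ t b))))

Incident : Pt → Pt → Set
Incident v t = ∃ λ a → corner t a ≡ v

incident-tile : ∀ {t a v} → corner t a ≡ v → t ≡ v -ₚ cornerOffset a
incident-tile {t} {a} eq = x+ₚy≡z⇒x≡z-ₚy (trans (sym (corner≡+ₚ t a)) eq)

corner-injectiveˡ : ∀ {t t' a} → corner t a ≡ corner t' a → t ≡ t'
corner-injectiveˡ {t' = t'} {a} eq = trans (incident-tile eq) (sym (incident-tile {t'} {a} refl))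

tilesAround : Pt → List Pt
tilesAround v = map (λ a → v -ₚ cornerOffset a) (allFin 3)

incident⇒∈tilesAround : ∀ {v t} → Incident v t → t ∈ tilesAround v
incident⇒∈tilesAround {v} (a , eq) =
  subst (_∈ tilesAround v) (sym (incident-tile eq)) (∈-map⁺ (λ a → v -ₚ cornerOffset a) (∈-allFin a))

incident-tiles-≤3 : ∀ {v ts} → Unique ts → All (Incident v) ts → length ts ≤ 3
incident-tiles-≤3 ts! incident = Unique⇒length≤ ts! (incident⇒∈tilesAround ∘ All.lookup incident)

four-tiles-share-no-corner : ∀ {v x y z w ts} → x ≢ y → x ∉ z ∷ w ∷ ts → y ∉ z ∷ w ∷ ts → z ≢ w →
                             All (Incident v) (x ∷ y ∷ z ∷ w ∷ []) → ⊥
four-tiles-share-no-corner x≢y x∉ y∉ z≢w incident =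
  ℕP.1+n≰n (incident-tiles-≤3 ((x≢y ∷ (x∉ ∘ here) ∷ (x∉ ∘ there ∘ here) ∷ [])
                             ∷ ((y∉ ∘ here) ∷ (y∉ ∘ there ∘ here) ∷ []) ∷ (z≢w ∷ []) ∷ [] ∷ []) incident)

tileOf-translate : ∀ t x y → tileOf (t +ₚ x) (t +ₚ y) ≡ t +ₚ tileOf x y
tileOf-translate (a , b) (x₁ , x₂) (y₁ , y₂) = cong₂ _,_
  (sym (ℤP.mono-≤-distrib-⊓ (ℤP.+-monoʳ-≤ a) x₁ y₁)) (sym (ℤP.mono-≤-distrib-⊓ (ℤP.+-monoʳ-≤ b) x₂ y₂))

tileOf-cornerOffsets : ∀ {a b} → a ≢ b → tileOf (cornerOffset a) (cornerOffset b) ≡ 0ₚ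
tileOf-cornerOffsets {c0} {c0} a≢b = contradiction refl a≢b
tileOf-cornerOffsets {c0} {c1} _   = refl
tileOf-cornerOffsets {c0} {c2} _   = refl
tileOf-cornerOffsets {c1} {c0} _   = refl
tileOf-cornerOffsets {c1} {c1} a≢b = contradiction refl a≢b
tileOf-cornerOffsets {c1} {c2} _   = refl
tileOf-cornerOffsets {c2} {c0} _   = refl
tileOf-cornerOffsets {c2} {c1} _   = refl
tileOf-cornerOffsets {c2} {c2} a≢b = contradiction refl a≢b

tileOf-corners : ∀ t {a b} → a ≢ b → tileOf (corner t a) (corner t b) ≡ t
tileOf-corners t {a} {b} a≢b = begin
  tileOf (corner t a) (corner t b)                   ≡⟨ cong₂ tileOf (corner≡+ₚ t a) (corner≡+ₚ t b) ⟩
  tileOf (t +ₚ cornerOffset a) (t +ₚ cornerOffset b) ≡⟨ tileOf-translate t _ _ ⟩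
  t +ₚ tileOf (cornerOffset a) (cornerOffset b)      ≡⟨ cong (t +ₚ_) (tileOf-cornerOffsets a≢b) ⟩
  t +ₚ 0ₚ                                            ≡⟨ +ₚ-identityʳ t ⟩
  t                                                  ∎
  where open ≡-Reasoning

record Side (t u v : Pt) : Set where
  constructor side
  field
    incidentˡ          : Incident u t
    incidentʳ          : Incident v t
    endpoints-distinct : u ≢ v

distinct-corners : ∀ {t a b} → corner t a ≢ corner t b → a ≢ b
distinct-corners u≢v refl = u≢v refl

side-tileOf : ∀ {t u v} → Side t u v → tileOf u v ≡ t
side-tileOf {t} (side (a , refl) (b , refl) u≢v) = tileOf-corners t (distinct-corners u≢v)

-- A step in direction d from a tile to the next passes through the corner `exit d` of the first
-- tile, which is the corner `entry d` of the second.
entry exit : Dir → Corner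
entry d0 = c0
entry d1 = c0
entry d2 = c1
entry d3 = c1
entry d4 = c2
entry d5 = c2
exit d0 = c1
exit d1 = c2
exit d2 = c2
exit d3 = c0
exit d4 = c0
exit d5 = c1

cornerOffset-step : ∀ d → cornerOffset (entry d) +ₚ step d ≡ cornerOffset (exit d)
cornerOffset-step d0 = refl
cornerOffset-step d1 = refl
cornerOffset-step d2 = refl
cornerOffset-step d3 = refl
cornerOffset-step d4 = refl
cornerOffset-step d5 = refl

entry≢exit : ∀ d → entry d ≢ exit d
entry≢exit d0 ()
entry≢exit d1 ()
entry≢exit d2 ()
entry≢exit d3 ()
entry≢exit d4 ()
entry≢exit d5 ()

side-direction : ∀ {a b} → a ≢ b → ∃ λ d → entry d ≡ a × exit d ≡ b
side-direction {c0} {c0} a≢b = contradiction refl a≢b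
side-direction {c0} {c1} _   = d0 , refl , refl
side-direction {c0} {c2} _   = d1 , refl , refl
side-direction {c1} {c0} _   = d3 , refl , refl
side-direction {c1} {c1} a≢b = contradiction refl a≢b
side-direction {c1} {c2} _   = d2 , refl , refl
side-direction {c2} {c0} _   = d4 , refl , refl
side-direction {c2} {c1} _   = d5 , refl , refl
side-direction {c2} {c2} a≢b = contradiction refl a≢b

corner-exit : ∀ t d → corner t (exit d) ≡ corner t (entry d) +ₚ step d
corner-exit t d = begin
  corner t (exit d)                       ≡⟨ corner≡+ₚ t (exit d) ⟩
  t +ₚ cornerOffset (exit d)              ≡⟨ cong (t +ₚ_) (cornerOffset-step d) ⟨
  t +ₚ (cornerOffset (entry d) +ₚ step d) ≡⟨ +ₚ-assoc t _ _ ⟨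
  (t +ₚ cornerOffset (entry d)) +ₚ step d ≡⟨ cong (_+ₚ step d) (corner≡+ₚ t (entry d)) ⟨
  corner t (entry d) +ₚ step d            ∎
  where open ≡-Reasoning

corner-step : ∀ t d → corner (t +ₚ step d) (entry d) ≡ corner t (exit d)
corner-step t d = begin
  corner (t +ₚ step d) (entry d)          ≡⟨ corner≡+ₚ (t +ₚ step d) (entry d) ⟩
  (t +ₚ step d) +ₚ cornerOffset (entry d) ≡⟨ +ₚ-assoc t _ _ ⟩
  t +ₚ (step d +ₚ cornerOffset (entry d)) ≡⟨ cong (t +ₚ_) (+ₚ-comm (step d) _) ⟩
  t +ₚ (cornerOffset (entry d) +ₚ step d) ≡⟨ cong (t +ₚ_) (cornerOffset-step d) ⟩
  t +ₚ cornerOffset (exit d)              ≡⟨ corner≡+ₚ t (exit d) ⟨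
  corner t (exit d)                       ∎
  where open ≡-Reasoning

exit≡entry : ∀ {p q} d → q ≡ p +ₚ step d → corner p (exit d) ≡ corner q (entry d)
exit≡entry {p} d refl = sym (corner-step p d)

side-adjacent : ∀ {t u v} → Side t u v → Adj u v
side-adjacent {t} (side (a , refl) (b , refl) u≢v) with side-direction (distinct-corners u≢v)
... | d , refl , refl = d , corner-exit t d

adjacent-side : ∀ {u v} → Adj u v → Side (tileOf u v) u v
adjacent-side {u} (d , refl) = subst (λ t → Side t u (u +ₚ step d)) (sym (side-tileOf s-side)) s-side
  where
  s : Pt
  s = u -ₚ cornerOffset (entry d)

  s-entry : corner s (entry d) ≡ u
  s-entry = trans (corner≡+ₚ s (entry d)) (x-ₚy+ₚy≡x u _)

  s-exit : corner s (exit d) ≡ u +ₚ step d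
  s-exit = trans (corner-exit s d) (cong (_+ₚ step d) s-entry)

  s-side : Side s u (u +ₚ step d)
  s-side = side (entry d , s-entry) (exit d , s-exit)
    (λ u≡v → entry≢exit d (corner-injectiveʳ s (trans s-entry (trans u≡v (sym s-exit)))))

common-corner-step : ∀ {t t' v} → t ≢ t' → Incident v t → Incident v t' →
                     ∃ λ d → t' ≡ t +ₚ step d × corner t (exit d) ≡ v × corner t' (entry d) ≡ v
common-corner-step {t} {t'} t≢t' (a , refl) (b , b-corner) with a ≟ᶠ b
... | yes refl = contradiction (corner-injectiveˡ (sym b-corner)) t≢t'
... | no a≢b with side-direction (a≢b ∘ sym)
...   | d , refl , refl = d , corner-injectiveˡ (trans b-corner (sym (corner-step t d))) , refl , b-corner

common-corner-unique : ∀ {t t' v w} → t ≢ t' → Incident v t → Incident v t' →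
                       Incident w t → Incident w t' → v ≡ w
common-corner-unique {v = v} {w} t≢t' vt vt' wt wt' with v ≟ₚ w
... | yes v≡w = v≡w
... | no v≢w  = contradiction
  (trans (sym (side-tileOf (side vt wt v≢w))) (side-tileOf (side vt' wt' v≢w))) t≢t'

forbidden : Dir → Dir
forbidden d0 = d4
forbidden d1 = d3
forbidden d2 = d0
forbidden d3 = d5
forbidden d4 = d2
forbidden d5 = d1

toℕ-forbidden : ∀ e → toℕ (forbidden e) ≡ (toℕ e ℕ.+ offset (toℕ e)) ℕ.% 6
toℕ-forbidden d0 = refl
toℕ-forbidden d1 = refl
toℕ-forbidden d2 = refl
toℕ-forbidden d3 = refl
toℕ-forbidden d4 = refl
toℕ-forbidden d5 = refl

entry≡exit-forbidden : ∀ e → entry e ≡ exit (forbidden e)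
entry≡exit-forbidden d0 = refl
entry≡exit-forbidden d1 = refl
entry≡exit-forbidden d2 = refl
entry≡exit-forbidden d3 = refl
entry≡exit-forbidden d4 = refl
entry≡exit-forbidden d5 = refl

entry≡exit⇒ : ∀ e d → entry e ≡ exit d → step e +ₚ step d ≡ 0ₚ ⊎ d ≡ forbidden e
entry≡exit⇒ d0 d0 ()
entry≡exit⇒ d0 d1 ()
entry≡exit⇒ d0 d2 ()
entry≡exit⇒ d0 d3 _ = inj₁ refl
entry≡exit⇒ d0 d4 _ = inj₂ refl
entry≡exit⇒ d0 d5 ()
entry≡exit⇒ d1 d0 ()
entry≡exit⇒ d1 d1 ()
entry≡exit⇒ d1 d2 ()
entry≡exit⇒ d1 d3 _ = inj₂ refl
entry≡exit⇒ d1 d4 _ = inj₁ refl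
entry≡exit⇒ d1 d5 ()
entry≡exit⇒ d2 d0 _ = inj₂ refl
entry≡exit⇒ d2 d1 ()
entry≡exit⇒ d2 d2 ()
entry≡exit⇒ d2 d3 ()
entry≡exit⇒ d2 d4 ()
entry≡exit⇒ d2 d5 _ = inj₁ refl
entry≡exit⇒ d3 d0 _ = inj₁ refl
entry≡exit⇒ d3 d1 ()
entry≡exit⇒ d3 d2 ()
entry≡exit⇒ d3 d3 ()
entry≡exit⇒ d3 d4 ()
entry≡exit⇒ d3 d5 _ = inj₂ refl
entry≡exit⇒ d4 d0 ()
entry≡exit⇒ d4 d1 _ = inj₁ refl
entry≡exit⇒ d4 d2 _ = inj₂ refl
entry≡exit⇒ d4 d3 ()
entry≡exit⇒ d4 d4 ()
entry≡exit⇒ d4 d5 ()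
entry≡exit⇒ d5 d0 ()
entry≡exit⇒ d5 d1 _ = inj₂ refl
entry≡exit⇒ d5 d2 _ = inj₁ refl
entry≡exit⇒ d5 d3 ()
entry≡exit⇒ d5 d4 ()
entry≡exit⇒ d5 d5 ()

side⇒allowed : ∀ {t u v e d} → Side t u v → corner t (entry e) ≡ u → corner t (exit d) ≡ v → Allowed e d
side⇒allowed {t} {u} {v} {e} {d} (side _ _ u≢v) u≡ v≡ d-forbidden = u≢v (begin
  u                             ≡⟨ u≡ ⟨
  corner t (entry e)            ≡⟨ cong (corner t) (entry≡exit-forbidden e) ⟩
  corner t (exit (forbidden e)) ≡⟨ cong (corner t ∘ exit) d≡forbidden ⟨
  corner t (exit d)             ≡⟨ v≡ ⟩
  v                             ∎)
  where
  open ≡-Reasoning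

  d≡forbidden : d ≡ forbidden e
  d≡forbidden = toℕ-injective (trans d-forbidden (sym (toℕ-forbidden e)))

allowed⇒side : ∀ {e d p⁻ p q} → Allowed e d → p ≡ p⁻ +ₚ step e → q ≡ p +ₚ step d → q ≢ p⁻ →
               Side p (corner p (entry e)) (corner p (exit d))
allowed⇒side {e} {d} {p⁻} allowed refl refl q≢p⁻ =
  side (entry e , refl) (exit d , refl) (entry≢exit-turn ∘ corner-injectiveʳ _)
  where
  entry≢exit-turn : entry e ≢ exit d
  entry≢exit-turn entry≡exit with entry≡exit⇒ e d entry≡exit
  ... | inj₁ reverses = q≢p⁻ (begin
    (p⁻ +ₚ step e) +ₚ step d ≡⟨ +ₚ-assoc p⁻ (step e) (step d) ⟩
    p⁻ +ₚ (step e +ₚ step d) ≡⟨ cong (p⁻ +ₚ_) reverses ⟩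
    p⁻ +ₚ 0ₚ                 ≡⟨ +ₚ-identityʳ p⁻ ⟩
    p⁻                       ∎)
    where open ≡-Reasoning
  ... | inj₂ refl = allowed (toℕ-forbidden e)

vertexA : Pt
vertexA = (0ℤ , 0ℤ)

vertexB : ℕ → Pt
vertexB n = (+ n , 0ℤ)

tileB : ℕ → Pt
tileB n = (+ n ℤ.- 1ℤ , 0ℤ)

corner-tileB : ∀ n → corner (tileB n) c1 ≡ vertexB n
corner-tileB n = cong (_, 0ℤ) (trans (ℤP.+-comm 1ℤ (+ n ℤ.- 1ℤ)) (ℤ-group.//-rightDividesˡ 1ℤ (+ n)))

dark-corner-vertex : ∀ {n} t a → DarkTile n t → Vertex n (corner t a)
dark-corner-vertex (+ i , + j) c0 (+≤+ _ , +≤+ _ , +<+ i+j<n) = +≤+ z≤n , +≤+ z≤n , +≤+ (ℕP.<⇒≤ i+j<n)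
dark-corner-vertex (+ i , + j) c1 (+≤+ _ , +≤+ _ , +<+ i+j<n) = +≤+ z≤n , +≤+ z≤n , +≤+ i+j<n
dark-corner-vertex {n} (+ i , + j) c2 (+≤+ _ , +≤+ _ , +<+ i+j<n) =
  +≤+ z≤n , +≤+ z≤n , +≤+ (subst (ℕ._≤ n) (sym (ℕP.+-suc i j)) i+j<n)

dark-from-corner1 : ∀ {n x y} → 0ℤ ℤ.≤ x → Vertex n (corner (x , y) c1) → DarkTile n (x , y)
dark-from-corner1 (+≤+ _) (_ , +≤+ _ , +≤+ i+j<n) = +≤+ z≤n , +≤+ z≤n , +<+ i+j<n

dark-from-corner2 : ∀ {n x y} → 0ℤ ℤ.≤ y → Vertex n (corner (x , y) c2) → DarkTile n (x , y)
dark-from-corner2 {n} {+ i} {+ j} (+≤+ _) (+≤+ _ , _ , +≤+ i+j<n) =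
  +≤+ z≤n , +≤+ z≤n , +<+ (subst (ℕ._≤ n) (ℕP.+-suc i j) i+j<n)

dark-from-corners : ∀ {n} t {a b} → a ≢ b → Vertex n (corner t a) → Vertex n (corner t b) → DarkTile n t
dark-from-corners t {c0} {c0} a≢b _ _ = contradiction refl a≢b
dark-from-corners t {c1} {c1} a≢b _ _ = contradiction refl a≢b
dark-from-corners t {c2} {c2} a≢b _ _ = contradiction refl a≢b
dark-from-corners t {c0} {c1} _ (0≤x , _ , _) v₁ = dark-from-corner1 0≤x v₁
dark-from-corners t {c1} {c0} _ v₁ (0≤x , _ , _) = dark-from-corner1 0≤x v₁
dark-from-corners t {c2} {c1} _ (0≤x , _ , _) v₁ = dark-from-corner1 0≤x v₁
dark-from-corners t {c1} {c2} _ v₁ (0≤x , _ , _) = dark-from-corner1 0≤x v₁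
dark-from-corners t {c0} {c2} _ (_ , 0≤y , _) v₂ = dark-from-corner2 0≤y v₂
dark-from-corners t {c2} {c0} _ v₂ (_ , 0≤y , _) = dark-from-corner2 0≤y v₂

side-dark : ∀ {n t u v} → Side t u v → Vertex n u → Vertex n v → DarkTile n t
side-dark {t = t} (side (a , refl) (b , refl) u≢v) = dark-from-corners t (distinct-corners u≢v)

¬dark-left-of-A : ∀ {n} → ¬ DarkTile n (-[1+ 0 ] , 0ℤ)
¬dark-left-of-A (() , _)

¬dark-B : ∀ {n} → ¬ DarkTile n (vertexB n)
¬dark-B {n} (_ , _ , +<+ n+0<n) = ℕP.m+n≮m n 0 n+0<n

dark-incident-A : ∀ {n t} → DarkTile n t → Incident vertexA t → t ≡ vertexA
dark-incident-A _ (c0 , t≡A) = t≡A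
dark-incident-A {t = + i , + j} (+≤+ _ , +≤+ _ , _) (c1 , ())
dark-incident-A {t = + i , + j} (+≤+ _ , +≤+ _ , _) (c2 , ())

dark-incident-B : ∀ {n t} → DarkTile n t → Incident (vertexB n) t → t ≡ tileB n
dark-incident-B t-dark (c0 , refl) = contradiction t-dark ¬dark-B
dark-incident-B {t = + i , + j} (+≤+ _ , +≤+ _ , _) (c1 , refl) = refl
dark-incident-B {t = + i , + j} (+≤+ _ , +≤+ _ , _) (c2 , ())

darkTiles : ℕ → List Pt
darkTiles zero    = []
darkTiles (suc n) = map (λ j → (0ℤ , + j)) (upTo (suc n)) ++ map (step d0 +ₚ_) (darkTiles n)

length-darkTiles : ∀ n → length (darkTiles n) ≡ T n
length-darkTiles zero    = refl
length-darkTiles (suc n) = begin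
  length (darkTiles (suc n))                                     ≡⟨ List.length-++ (map _ (upTo (suc n))) ⟩
  length (map _ (upTo (suc n))) ℕ.+ length (map _ (darkTiles n)) ≡⟨ cong₂ ℕ._+_ (List.length-map _ (upTo (suc n)))
                                                                                   (List.length-map _ (darkTiles n)) ⟩
  length (upTo (suc n)) ℕ.+ length (darkTiles n)                 ≡⟨ cong₂ ℕ._+_ (List.length-upTo (suc n)) (length-darkTiles n) ⟩
  suc n ℕ.+ T n                                                  ∎
  where open ≡-Reasoning

darkTiles-sound : ∀ n {t} → t ∈ darkTiles n → DarkTile n t
darkTiles-sound (suc n) t∈ with ∈-++⁻ (map _ (upTo (suc n))) t∈
... | inj₁ t∈column with ∈-map⁻ _ t∈column
...   | j , j∈ , refl = +≤+ z≤n , +≤+ z≤n , +<+ (∈-upTo⁻ j∈)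
darkTiles-sound (suc n) t∈ | inj₂ t∈shifted with ∈-map⁻ _ t∈shifted
... | w , w∈ , refl with darkTiles-sound n w∈
...   | +≤+ _ , +≤+ _ , +<+ i+j<n = +≤+ z≤n , +≤+ z≤n , +<+ (s≤s i+j<n)

darkTiles-complete : ∀ n {t} → DarkTile n t → t ∈ darkTiles n
darkTiles-complete (suc n) {+ zero , + j} (_ , +≤+ _ , +<+ j<n) = ∈-++⁺ˡ (∈-map⁺ _ (∈-upTo⁺ j<n))
darkTiles-complete (suc n) {+ suc i , + j} (_ , +≤+ _ , +<+ (s≤s i+j<n)) =
  ∈-++⁺ʳ _ (∈-map⁺ _ (darkTiles-complete n (+≤+ z≤n , +≤+ z≤n , +<+ i+j<n)))

darkTiles-unique : ∀ n → Unique (darkTiles n)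
darkTiles-unique zero    = []
darkTiles-unique (suc n) = Unique.++⁺
  (Unique.map⁺ (ℤP.+-injective ∘ cong proj₂) (Unique.upTo⁺ (suc n)))
  (Unique.map⁺ (+ₚ-cancelˡ (step d0)) (darkTiles-unique n))
  disjoint
  where
  disjoint : ∀ {t} → ¬ (t ∈ map _ (upTo (suc n)) × t ∈ map (step d0 +ₚ_) (darkTiles n))
  disjoint (t∈column , t∈shifted) with ∈-map⁻ _ t∈column | ∈-map⁻ _ t∈shifted
  ... | _ , _ , refl | w , w∈ , t≡ with darkTiles-sound n w∈
  ...   | +≤+ _ , +≤+ _ , _ with cong proj₁ t≡
  ...     | ()

covering⇒length : ∀ {n H} → Unique H → All (DarkTile n) H → (∀ t → DarkTile n t → t ∈ H) → length H ≡ T n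
covering⇒length {n} H! H-dark covers = trans
  (ℕP.≤-antisym (Unique⇒length≤ H! (darkTiles-complete n ∘ All.lookup H-dark))
                (Unique⇒length≤ (darkTiles-unique n) (covers _ ∘ darkTiles-sound n)))
  (length-darkTiles n)

length⇒covering : ∀ {n H} → Unique H → All (DarkTile n) H → length H ≡ T n → ∀ t → DarkTile n t → t ∈ H
length⇒covering {n} {H} H! H-dark |H|≡Tn t t-dark with Any.any? (t ≟ₚ_) H
... | yes t∈H = t∈H
... | no  t∉H = contradiction (subst (suc (length H) ≤_) (trans (length-darkTiles n) (sym |H|≡Tn))
  (Unique⇒length≤ (All.tabulate (λ t'∈H t≡t' → t∉H (subst (_∈ H) (sym t≡t') t'∈H)) ∷ H!)
    λ { (here refl) → darkTiles-complete n t-dark ; (there t'∈H) → darkTiles-complete n (All.lookup H-dark t'∈H) }))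
  ℕP.1+n≰n

data Sides : List Pt → List Pt → Set where
  single : ∀ v → Sides [ v ] []
  _∷_    : ∀ {u v P t ts} → Side t u v → Sides (v ∷ P) ts → Sides (u ∷ v ∷ P) (t ∷ ts)

adjacent⇒sides : ∀ {u P} → Linked Adj (u ∷ P) → Sides (u ∷ P) (Φ (u ∷ P))
adjacent⇒sides {u} {[]}    _          = single u
adjacent⇒sides {u} {v ∷ P} (adj ∷ L) = adjacent-side adj ∷ adjacent⇒sides L

sides⇒adjacent : ∀ {P ts} → Sides P ts → Linked Adj P
sides⇒adjacent (single _)         = [-]
sides⇒adjacent (s ∷ single _)     = side-adjacent s ∷ [-]
sides⇒adjacent (s ∷ ss@(_ ∷ _)) = side-adjacent s ∷ sides⇒adjacent ss

sides⇒Φ : ∀ {P ts} → Sides P ts → Φ P ≡ ts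
sides⇒Φ (single _) = refl
sides⇒Φ (s ∷ ss)   = cong₂ _∷_ (side-tileOf s) (sides⇒Φ ss)

sides-length : ∀ {P ts} → Sides P ts → length P ≡ suc (length ts)
sides-length (single _) = refl
sides-length (_ ∷ ss)   = cong suc (sides-length ss)

sides-dark : ∀ {n P ts} → Sides P ts → All (Vertex n) P → All (DarkTile n) ts
sides-dark (single _) _               = []
sides-dark (s ∷ ss)   (u-in ∷ vs-in) = side-dark s u-in (All.head vs-in) ∷ sides-dark ss vs-in

sides-vertices : ∀ {n u P t ts} → Sides (u ∷ P) (t ∷ ts) → All (DarkTile n) (t ∷ ts) → All (Vertex n) (u ∷ P)
sides-vertices (side (a , refl) (b , refl) _ ∷ single _) (t-dark ∷ []) =
  dark-corner-vertex _ a t-dark ∷ dark-corner-vertex _ b t-dark ∷ []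
sides-vertices (side (a , refl) _ _ ∷ ss@(_ ∷ _)) (t-dark ∷ ts-dark) =
  dark-corner-vertex _ a t-dark ∷ sides-vertices ss ts-dark

sides-last-tile : ∀ {n u P t ts} → Sides (u ∷ P) (t ∷ ts) → All (DarkTile n) (t ∷ ts) →
                  last (u ∷ P) ≡ just (vertexB n) → last (t ∷ ts) ≡ just (tileB n)
sides-last-tile (side _ (b , v≡) _ ∷ single _) (t-dark ∷ []) last≡ =
  cong just (dark-incident-B t-dark (b , trans v≡ (just-injective last≡)))
sides-last-tile (_ ∷ ss@(_ ∷ _)) (_ ∷ ts-dark) last≡ = sides-last-tile ss ts-dark last≡

sides-injective : ∀ {u P Q ts} → Sides (u ∷ P) ts → Sides (u ∷ Q) ts → Unique ts →
                  last (u ∷ P) ≡ last (u ∷ Q) → P ≡ Q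
sides-injective (single _)     (single _)     _ _     = refl
sides-injective (_ ∷ single _) (_ ∷ single _) _ last≡ = cong [_] (just-injective last≡)
sides-injective (s ∷ ss@(s₂ ∷ _)) (s' ∷ ss'@(s₂' ∷ _)) ((t≢t' ∷ _) ∷ ts!) last≡
  with common-corner-unique t≢t' (Side.incidentʳ s) (Side.incidentˡ s₂) (Side.incidentʳ s') (Side.incidentˡ s₂')
... | refl = cong₂ _∷_ refl (sides-injective ss ss' ts! last≡)

sides-walk : ∀ {e f s u P t ts} → Sides (u ∷ P) (t ∷ ts) → Unique (t ∷ ts) → corner t (entry e) ≡ u →
             last (t ∷ ts) ≡ just s → last (u ∷ P) ≡ just (corner s (exit f)) →
             Σ (List Dir) λ h → Walk (t ∷ ts) h × Linked Allowed (e ∷ h ++ [ f ])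
sides-walk {t = t} (s ∷ single _) _ u≡ refl v≡ =
  [] , single t , side⇒allowed s u≡ (sym (just-injective v≡)) ∷ [-]
sides-walk (s ∷ ss@(s' ∷ _)) ((t≢t' ∷ _) ∷ ts!) u≡ last-t last-v
  with common-corner-step t≢t' (Side.incidentʳ s) (Side.incidentˡ s')
... | d , t'≡ , exit≡v , entry≡v with sides-walk ss ts! entry≡v last-t last-v
...   | h , w , turns = d ∷ h , step∷ d t'≡ w , side⇒allowed s u≡ exit≡v ∷ turns

lastTile : ∀ {p ps ds} → Walk (p ∷ ps) ds → Pt
lastTile (single p)    = p
lastTile (step∷ _ _ w) = lastTile w

last≡lastTile : ∀ {p ps ds} (w : Walk (p ∷ ps) ds) → last (p ∷ ps) ≡ just (lastTile w)
last≡lastTile (single _)    = refl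
last≡lastTile (step∷ _ _ w) = last≡lastTile w

-- A walk entered in direction e and left in direction f is treated as having two extra, virtual
-- tiles: one before its first tile and `lastTile w +ₚ step f` after its last, so that its first
-- and last vertices are corners shared with neighbouring tiles like all the others.
continued : ∀ {p ps ds} → Walk (p ∷ ps) ds → Dir → List Pt
continued {p} {ps} w f = p ∷ ps ++ [ lastTile w +ₚ step f ]

exits : ∀ {p ps ds} → Walk (p ∷ ps) ds → Dir → List Pt
exits (single p)        f = [ corner p (exit f) ]
exits (step∷ {p} d _ w) f = corner p (exit d) ∷ exits w f

cornerPath : Dir → ∀ {p ps ds} → Walk (p ∷ ps) ds → Dir → List Pt
cornerPath e {p} w f = corner p (entry e) ∷ exits w f

last-cornerPath : ∀ {e p ps ds} (w : Walk (p ∷ ps) ds) f →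
                  last (cornerPath e w f) ≡ just (corner (lastTile w) (exit f))
last-cornerPath     (single _)                  f = refl
last-cornerPath {e} (step∷ _ _ w@(single _))     f = last-cornerPath {e} w f
last-cornerPath {e} (step∷ _ _ w@(step∷ _ _ _)) f = last-cornerPath {e} w f

-- An exit vertex equal to v would also be a corner of two consecutive tiles of the walk: four in all.
exits-avoid : ∀ {v x y q qs ds f} (w : Walk (q ∷ qs) ds) → Incident v x → Incident v y → x ≢ y →
              x ∉ continued w f → y ∉ continued w f → Unique (continued w f) → All (v ≢_) (exits w f)
exits-avoid {v} {f = f} (single q) vx vy x≢y x∉ y∉ ((q≢q⁺ ∷ []) ∷ _) = v≢exit ∷ []
  where
  v≢exit : v ≢ corner q (exit f)
  v≢exit refl = four-tiles-share-no-corner x≢y x∉ y∉ q≢q⁺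
    (vx ∷ vy ∷ (exit f , refl) ∷ (entry f , corner-step q f) ∷ [])
exits-avoid {v} (step∷ {q} d q'≡ w) vx vy x≢y x∉ y∉ ((q≢q' ∷ _) ∷ ts!) =
  v≢exit ∷ exits-avoid w vx vy x≢y (x∉ ∘ there) (y∉ ∘ there) ts!
  where
  v≢exit : v ≢ corner q (exit d)
  v≢exit refl = four-tiles-share-no-corner x≢y x∉ y∉ q≢q'
    (vx ∷ vy ∷ (exit d , refl) ∷ (entry d , sym (exit≡entry d q'≡)) ∷ [])

cornerPath-sides : ∀ {e f p⁻ p ps ds} (w : Walk (p ∷ ps) ds) → p ≡ p⁻ +ₚ step e →
                   Unique (p⁻ ∷ continued w f) → Linked Allowed (e ∷ ds ++ [ f ]) →
                   Sides (cornerPath e w f) (p ∷ ps)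
cornerPath-sides (single p) p≡ ((_ ∷ p⁻≢q⁺ ∷ []) ∷ _) (allowed ∷ _) =
  allowed⇒side allowed p≡ refl (p⁻≢q⁺ ∘ sym) ∷ single _
cornerPath-sides {f = f} (step∷ d q≡ w) p≡ ((_ ∷ p⁻≢q ∷ _) ∷ ts!) (allowed ∷ turns) =
  allowed⇒side allowed p≡ q≡ (p⁻≢q ∘ sym)
    ∷ subst (λ v → Sides (v ∷ exits w f) _) (sym (exit≡entry d q≡)) (cornerPath-sides w q≡ ts! turns)

cornerPath-unique : ∀ {e f p⁻ p ps ds} (w : Walk (p ∷ ps) ds) → p ≡ p⁻ +ₚ step e →
                    Unique (p⁻ ∷ continued w f) → Linked Allowed (e ∷ ds ++ [ f ]) → Unique (cornerPath e w f)
cornerPath-unique (single p) p≡ ((_ ∷ p⁻≢q⁺ ∷ []) ∷ _) (allowed ∷ _) =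
  (Side.endpoints-distinct (allowed⇒side allowed p≡ refl (p⁻≢q⁺ ∘ sym)) ∷ []) ∷ [] ∷ []
cornerPath-unique {e} {f} (step∷ d q≡ w) p≡ ((p⁻≢p ∷ p⁻∉) ∷ p∷ts!@(p∉ ∷ ts!)) (allowed ∷ turns) =
  (Side.endpoints-distinct (allowed⇒side allowed p≡ q≡ (All.head p⁻∉ ∘ sym))
     ∷ exits-avoid w (exit e , exit≡entry e p≡) (entry e , refl) p⁻≢p (All¬⇒¬Any p⁻∉) (All¬⇒¬Any p∉) ts!)
  ∷ subst (λ v → Unique (v ∷ exits w f)) (sym (exit≡entry d q≡)) (cornerPath-unique w q≡ p∷ts! turns)

spath-shape : ∀ {n P} → 1 ≤ n → SPath n P → ∃ λ v → ∃ λ P' → P ≡ vertexA ∷ v ∷ P'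
spath-shape {P = []}         _       S with SPath.start S
... | ()
spath-shape {P = _ ∷ []}     (s≤s _) S with SPath.nEdges S
... | ()
spath-shape {P = _ ∷ v ∷ P'} _       S with SPath.start S
... | refl = v , P' , refl

spath⇒wpath : ∀ {n} P → 1 ≤ n → SPath n P → WPath n (Φ P)
spath⇒wpath {n} P 1≤n S with spath-shape 1≤n S
... | v , P' , refl = proj₁ walk-turns , hpath , proj₂ (proj₂ walk-turns)
  where
  sides : Sides (vertexA ∷ v ∷ P') (Φ (vertexA ∷ v ∷ P'))
  sides = adjacent⇒sides (SPath.edges S)

  tiles-dark : All (DarkTile n) (Φ (vertexA ∷ v ∷ P'))
  tiles-dark = sides-dark sides (SPath.inGrid S)

  first-tile : tileOf vertexA v ≡ vertexA
  first-tile = dark-incident-A (All.head tiles-dark) (Side.incidentˡ (adjacent-side (Linked.head (SPath.edges S))))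

  last-tile : last (Φ (vertexA ∷ v ∷ P')) ≡ just (tileB n)
  last-tile = sides-last-tile sides tiles-dark (SPath.end S)

  walk-turns : Σ (List Dir) λ h → Walk (Φ (vertexA ∷ v ∷ P')) h × WellFormed h
  walk-turns = sides-walk sides (SPath.tilesDist S) first-tile last-tile
                 (trans (SPath.end S) (cong just (sym (corner-tileB n))))

  hpath : HPath n (Φ (vertexA ∷ v ∷ P')) (proj₁ walk-turns)
  hpath = record
    { walk     = proj₁ (proj₂ walk-turns)
    ; start    = cong just first-tile
    ; end      = last-tile
    ; inGrid   = tiles-dark
    ; distinct = SPath.tilesDist S
    ; covers   = length⇒covering (SPath.tilesDist S) tiles-dark
                   (ℕP.suc-injective (trans (sym (sides-length sides)) (SPath.nEdges S)))
    }

spath-injective : ∀ {n} P Q → 1 ≤ n → SPath n P → SPath n Q → Φ P ≡ Φ Q → P ≡ Q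
spath-injective P Q 1≤n SP SQ Φ≡ with spath-shape 1≤n SP | spath-shape 1≤n SQ
... | _ , _ , refl | _ , _ , refl = cong₂ _∷_ refl (sides-injective
  (adjacent⇒sides (SPath.edges SP)) (subst (Sides _) (sym Φ≡) (adjacent⇒sides (SPath.edges SQ)))
  (SPath.tilesDist SP) (trans (SPath.end SP) (sym (SPath.end SQ))))

wpath⇒spath : ∀ {n} H → WPath n H → Σ (List Pt) λ P → SPath n P × Φ P ≡ H
wpath⇒spath []          (_ , hpath , _) with HPath.start hpath
... | ()
wpath⇒spath {n} (_ ∷ H) (_ , hpath , turns) with HPath.start hpath
... | refl = P , S , sides⇒Φ sides
  where
  open HPath hpath

  P : List Pt
  P = cornerPath d0 walk d0

  beyond≡B : lastTile walk +ₚ step d0 ≡ vertexB n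
  beyond≡B = trans (sym (corner-exit (lastTile walk) d0))
               (trans (cong (λ s → corner s c1) (just-injective (trans (sym (last≡lastTile walk)) end)))
                      (corner-tileB n))

  continued! : Unique ((-[1+ 0 ] , 0ℤ) ∷ continued walk d0)
  continued! = subst (λ b → Unique (_ ∷ vertexA ∷ H ++ [ b ])) (sym beyond≡B)
    (unique-between distinct inGrid ¬dark-left-of-A ¬dark-B (λ ()))

  sides : Sides P (vertexA ∷ H)
  sides = cornerPath-sides walk refl continued! turns

  S : SPath n P
  S = record
    { start     = refl
    ; end       = trans (last-cornerPath {e = d0} walk d0)
                    (cong just (trans (corner-exit (lastTile walk) d0) beyond≡B))
    ; nEdges    = trans (sides-length sides) (cong suc (covering⇒length distinct inGrid covers))
    ; edges     = sides⇒adjacent sides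
    ; inGrid    = sides-vertices sides inGrid
    ; selfAvoid = cornerPath-unique walk refl continued! turns
    ; tilesDist = subst Unique (sym (sides⇒Φ sides)) distinct
    }

theorem1 : (n : ℕ) → 1 ≤ n →
    ((P : List Pt) → SPath n P → WPath n (Φ P)) ×
    ((P Q : List Pt) → SPath n P → SPath n Q → Φ P ≡ Φ Q → P ≡ Q) ×
    ((H : List Pt) → WPath n H → Σ (List Pt) (λ P → SPath n P × Φ P ≡ H))
theorem1 n 1≤n = (λ P → spath⇒wpath P 1≤n) , (λ P Q → spath-injective P Q 1≤n) , wpath⇒spath
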